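{- For $n\ge 3$, $\mathrm{edim}_f(C_n)=\frac{n}{n-1}$ if $n$ is odd, and $\mathrm{edim}_f(C_n)=\frac{n}{n-2}$ if $n$ is even, where $C_n$ is the cycle on $n$ vertices.
   Context: All graphs are finite, simple, undirected; $d(u,w)$ is the length of a shortest $u$–$w$ path. For a vertex $v$ and an edge $e=xy$, $d(e,v)=\min\{d(x,v),d(y,v)\}$; for distinct edges $e_1,e_2$, $R_e\{e_1,e_2\}=\{v: d(v,e_1)\neq d(v,e_2)\}$. For $g:V\to\mathbb{R}$ and $U\subseteq V$, $g(U)=\sum_{s\in U}g(s)$. A function $g:V(G)\to[0,1]$ is an edge resolving function of $G$ if $g(R_e\{e_1,e_2\})\ge1$ for all distinct edges $e_1,e_2$, and $\mathrm{edim}_f(G)=\min\{g(V(G)): g\text{ an edge resolving function of }G\}$.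
   Formalization: The edge resolving functions g take values in the rationals of [0,1] instead of the reals. -}

module Defs where

open import Data.Nat as ℕ using (ℕ; zero; suc; _∸_; _%_; _≡ᵇ_; z<s; s≤s)
open import Data.Bool using (Bool; true; false; _∨_; _∧_; if_then_else_; T; not)
open import Data.Fin using (Fin; toℕ) renaming (zero to fzero; suc to fsuc)
open import Data.Fin.Properties using () renaming (_≟_ to _≟F_)
open import Data.Integer using (+_)
open import Data.Rational using (ℚ; 0ℚ; 1ℚ; _+_; _≤_; _/_)
open import Data.Product using (Σ; _×_; _,_)
open import Relation.Binary.PropositionalEquality using (_≡_)
open import Relation.Nullary using (¬_)
open import Relation.Nullary.Decidable using (isYes)

Graph : ℕ → Set
Graph n = Fin n → Fin n → Bool

anyFin : ∀ {n} → (Fin n → Bool) → Bool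
anyFin {zero}  f = false
anyFin {suc n} f = f fzero ∨ anyFin (λ i → f (fsuc i))

sumFin : ∀ {n} → (Fin n → ℚ) → ℚ
sumFin {zero}  f = 0ℚ
sumFin {suc n} f = f fzero + sumFin (λ i → f (fsuc i))

reach : ∀ {n} → Graph n → ℕ → Fin n → Fin n → Bool
reach G zero    u w = isYes (u ≟F w)
reach G (suc k) u w = reach G k u w ∨ anyFin (λ x → reach G k u x ∧ G x w)

-- least k < b with p k, or b if none
firstTrue : (ℕ → Bool) → ℕ → ℕ
firstTrue p zero    = zero
firstTrue p (suc b) = if p zero then zero else suc (firstTrue (λ k → p (suc k)) b)

-- shortest path distance d(u,w) (every distance in a connected n-vertex graph is < n)
dist : ∀ {n} → Graph n → Fin n → Fin n → ℕ
dist {n} G u w = firstTrue (λ k → reach G k u w) n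

Edge : ∀ {n} → Graph n → Set
Edge {n} G = Σ (Fin n) λ x → Σ (Fin n) λ y → T (G x y)

-- distinct as edges (unordered pairs)
DistinctEdges : ∀ {n} {G : Graph n} → Edge G → Edge G → Set
DistinctEdges (x₁ , y₁ , _) (x₂ , y₂ , _) =
  ¬ (x₁ ≡ x₂ × y₁ ≡ y₂) × ¬ (x₁ ≡ y₂ × y₁ ≡ x₂)

edgeDist : ∀ {n} (G : Graph n) → Edge G → Fin n → ℕ
edgeDist G (x , y , _) v = ℕ._⊓_ (dist G x v) (dist G y v)

inR : ∀ {n} (G : Graph n) → Edge G → Edge G → Fin n → Bool
inR G e₁ e₂ v = not (edgeDist G e₁ v ≡ᵇ edgeDist G e₂ v)

weight : ∀ {n} → (Fin n → ℚ) → (Fin n → Bool) → ℚ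
weight g U = sumFin (λ v → if U v then g v else 0ℚ)

IsEdgeResolving : ∀ {n} (G : Graph n) → (Fin n → ℚ) → Set
IsEdgeResolving {n} G g =
  ((v : Fin n) → 0ℚ ≤ g v × g v ≤ 1ℚ) ×
  ((e₁ e₂ : Edge G) → DistinctEdges {G = G} e₁ e₂ → 1ℚ ≤ weight g (inR G e₁ e₂))

FracEdgeDim : ∀ {n} (G : Graph n) → ℚ → Set
FracEdgeDim {n} G q =
  (Σ (Fin n → ℚ) λ g → IsEdgeResolving G g × weight g (λ _ → true) ≡ q) ×
  ((g : Fin n → ℚ) → IsEdgeResolving G g → q ≤ weight g (λ _ → true))

-- the cycle C_n on vertices 0,…,n-1, i ~ j iff j ≡ i ± 1 (mod n)
cycle : (n : ℕ) → Graph n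
cycle n i j =
  (suc (toℕ i) ≡ᵇ toℕ j) ∨ (suc (toℕ j) ≡ᵇ toℕ i) ∨
  ((toℕ i ≡ᵇ 0) ∧ (suc (toℕ j) ≡ᵇ n)) ∨ ((toℕ j ≡ᵇ 0) ∧ (suc (toℕ i) ≡ᵇ n))

ratio : ℕ → (b : ℕ) → 0 ℕ.< b → ℚ
ratio a (suc b) _ = (+ a) / suc b

n∸1>0 : ∀ {n} → 3 ℕ.≤ n → 0 ℕ.< n ∸ 1
n∸1>0 (s≤s (s≤s _)) = z<s

n∸2>0 : ∀ {n} → 3 ℕ.≤ n → 0 ℕ.< n ∸ 2
n∸2>0 (s≤s (s≤s (s≤s _))) = z<s

module Submission where

-- Number the vertices of C_n by their residues mod n. Doubling every residue turns the edge {x, x ± 1}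
-- into the odd point m = 2x ± 1 of C_2n, distinct edges into distinct points, and 2 d(e, v) + 1 is
-- the distance from 2v to m in C_2n. So if v is equidistant from distinct edges with midpoints m₁, m₂,
-- then 2v ≡ m₁ + s ≡ m₂ - s (mod 2n) for some s, whence 4v ≡ m₁ + m₂ (mod 2n): all such v agree in 2v mod n.
-- Hence at most one vertex (n odd), or an antipodal pair (n even), fails to resolve two distinct edges,
-- and the constant function 1/(n-1), resp. 1/(n-2), is edge resolving.
-- Conversely, the two edges at y are resolved neither by y nor, for even n, by its antipode; summing
-- g(V) - g(y) ≥ 1, resp. g(V) - g(y) - g(antipode y) ≥ 1, over all n vertices y gives
-- (n - 1) g(V) ≥ n, resp. (n - 2) g(V) ≥ n.

open import Algebra.Bundles using (CommutativeRing)
import Algebra.Properties.Semiring.Mult as SemiringMult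
import Algebra.Properties.Semiring.Sum as SemiringSum
open import Data.Bool using (Bool; true; false; T; _∨_; _∧_; if_then_else_)
import Data.Bool.Properties as Boolₚ
open import Data.Empty using (⊥-elim)
open import Data.Fin as Fin using (Fin; toℕ) renaming (zero to fzero; suc to fsuc)
open import Data.Fin.Permutation using (Permutation′; permutation; _⟨$⟩ʳ_)
import Data.Fin.Properties as Finₚ
open import Data.Integer as ℤ using (ℤ; +_; -[1+_]; +[1+_]; ∣_∣; 0ℤ; 1ℤ; -1ℤ; _+_; _-_; _*_; -_)
import Data.Integer.DivMod as ℤ
import Data.Integer.Properties as ℤₚ
open import Data.Integer.Tactic.RingSolver using (solve-∀; solve)
open import Data.List using ([]; _∷_)
open import Data.Nat as ℕ using (ℕ; zero; suc; z≤n; s≤s; _≡ᵇ_; _≤_; _<_; _%_; _∸_)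
import Data.Nat.DivMod as ℕ
import Data.Nat.Properties as ℕₚ
import Data.Nat.Tactic.RingSolver as ℕ-Solver
open import Data.Product as Product using (Σ; ∃; _×_; _,_; proj₁; proj₂)
open import Data.Rational as ℚ using (ℚ; 0ℚ; 1ℚ; _/_)
import Data.Rational.Properties as ℚₚ
import Data.Rational.Unnormalised as ℚᵘ
import Data.Rational.Unnormalised.Properties as ℚᵘₚ
open import Data.Sum as Sum using (_⊎_; inj₁; inj₂)
open import Data.Unit using (tt)
open import Function using (_∘_; id; Equivalence)
open import Relation.Binary.Bundles using (Setoid)
import Relation.Binary.Reasoning.Setoid as SetoidReasoning
open import Relation.Binary.PropositionalEquality
open import Relation.Nullary using (¬_; yes; no)
open import Relation.Nullary.Decidable using (does; toWitness; fromWitness)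

open import Defs

-- Congruence modulo an integer

infix 4 _≡_mod_

record _≡_mod_ (a b m : ℤ) : Set where
  constructor congruent
  field
    quotient : ℤ
    a≡b+qm   : a ≡ b + quotient * m

module _ {m : ℤ} where

  mod-reflexive : ∀ {a b} → a ≡ b → a ≡ b mod m
  mod-reflexive {a} refl = congruent 0ℤ (solve (a ∷ m ∷ []))

  mod-refl : ∀ {a} → a ≡ a mod m
  mod-refl = mod-reflexive refl

  mod-sym : ∀ {a b} → a ≡ b mod m → b ≡ a mod m
  mod-sym {b = b} (congruent q refl) = congruent (- q) (solve (b ∷ q ∷ m ∷ []))

  mod-trans : ∀ {a b c} → a ≡ b mod m → b ≡ c mod m → a ≡ c mod m
  mod-trans {c = c} (congruent q refl) (congruent r refl) = congruent (r + q) (solve (c ∷ q ∷ r ∷ m ∷ []))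

  mod-setoid : Setoid _ _
  mod-setoid = record
    { Carrier       = ℤ
    ; _≈_           = _≡_mod m
    ; isEquivalence = record { refl = mod-refl ; sym = mod-sym ; trans = mod-trans }
    }

  +-cong-mod : ∀ {a b c d} → a ≡ b mod m → c ≡ d mod m → a + c ≡ b + d mod m
  +-cong-mod {b = b} {d = d} (congruent q refl) (congruent r refl) =
    congruent (q + r) (solve (b ∷ d ∷ q ∷ r ∷ m ∷ []))

  *-congˡ-mod : ∀ k {a b} → a ≡ b mod m → k * a ≡ k * b mod m
  *-congˡ-mod k {b = b} (congruent q refl) = congruent (k * q) (solve (k ∷ b ∷ q ∷ m ∷ []))

  +-cancelʳ-mod : ∀ c {a b} → a + c ≡ b + c mod m → a ≡ b mod m
  +-cancelʳ-mod c {a} {b} (congruent q eq) = congruent q (begin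
    a                  ≡⟨ solve (a ∷ c ∷ []) ⟩
    a + c - c          ≡⟨ cong (_- c) eq ⟩
    b + c + q * m - c  ≡⟨ solve (b ∷ c ∷ q ∷ m ∷ []) ⟩
    b + q * m          ∎)
    where open ≡-Reasoning

  modulus≡0 : m ≡ 0ℤ mod m
  modulus≡0 = congruent 1ℤ (solve (m ∷ []))

module ModReasoning (m : ℤ) = SetoidReasoning (mod-setoid {m})

*-cancelˡ-mod : ∀ k .{{_ : ℤ.NonZero k}} {a b m} → k * a ≡ k * b mod k * m → a ≡ b mod m
*-cancelˡ-mod k {a} {b} {m} (congruent q eq) = congruent q (ℤₚ.*-cancelˡ-≡ k a (b + q * m) (begin
  k * a                ≡⟨ eq ⟩
  k * b + q * (k * m)  ≡⟨ solve (k ∷ b ∷ q ∷ m ∷ []) ⟩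
  k * (b + q * m)      ∎))
  where open ≡-Reasoning

mod-small⇒≡ : ∀ {a b m} → ∣ a - b ∣ < ∣ m ∣ → a ≡ b mod m → a ≡ b
mod-small⇒≡ {a} {b} {m} ∣a-b∣<∣m∣ (congruent q eq) =
  trans eq (trans (cong (λ q → b + q * m) q≡0) (solve (b ∷ m ∷ [])))
  where
  a-b≡qm : a - b ≡ q * m
  a-b≡qm = trans (cong (_- b) eq) (solve (b ∷ q ∷ m ∷ []))
  ∣q∣*∣m∣<1*∣m∣ : ∣ q ∣ ℕ.* ∣ m ∣ < 1 ℕ.* ∣ m ∣
  ∣q∣*∣m∣<1*∣m∣ = begin-strict
    ∣ q ∣ ℕ.* ∣ m ∣  ≡⟨ ℤₚ.∣i*j∣≡∣i∣*∣j∣ q m ⟨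
    ∣ q * m ∣        ≡⟨ cong ∣_∣ a-b≡qm ⟨
    ∣ a - b ∣        <⟨ ∣a-b∣<∣m∣ ⟩
    ∣ m ∣            ≡⟨ ℕₚ.*-identityˡ ∣ m ∣ ⟨
    1 ℕ.* ∣ m ∣      ∎
    where open ℕₚ.≤-Reasoning
  q≡0 : q ≡ 0ℤ
  q≡0 = ℤₚ.∣i∣≡0⇒i≡0 (ℕₚ.n<1⇒n≡0 (ℕₚ.*-cancelʳ-< ∣ m ∣ ∣ q ∣ 1 ∣q∣*∣m∣<1*∣m∣))

∣+a-+b∣<n : ∀ {a b n} → a < n → b < n → ∣ + a - + b ∣ < n
∣+a-+b∣<n {a} {b} {n} a<n b<n = begin-strict
  ∣ + a - + b ∣   ≡⟨ cong ∣_∣ (ℤₚ.m-n≡m⊖n a b) ⟩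
  ∣ a ℤ.⊖ b ∣     ≤⟨ ℤₚ.∣m⊝n∣≤m⊔n a b ⟩
  a ℕ.⊔ b         <⟨ ℕₚ.⊔-pres-<m a<n b<n ⟩
  n               ∎
  where open ℕₚ.≤-Reasoning

+-mod-bounded⇒≡ : ∀ {a b n} → a < n → b < n → + a ≡ + b mod + n → a ≡ b
+-mod-bounded⇒≡ a<n b<n = ℤₚ.+-injective ∘ mod-small⇒≡ (∣+a-+b∣<n a<n b<n)

mod-halves : ∀ {a b m} → a ≡ b mod m → a ≡ b mod m + m ⊎ a ≡ b + m mod m + m
mod-halves {a} {b} {m} (congruent q eq)
  with q ℤ.%ℕ 2 | q ℤ./ℕ 2 | ℤ.n%ℕd<d q 2 | ℤ.a≡a%ℕn+[a/ℕn]*n q 2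
... | 0 | k | _ | q≡2k = inj₁ (congruent k (begin
  a                        ≡⟨ eq ⟩
  b + q * m                ≡⟨ cong (λ q → b + q * m) q≡2k ⟩
  b + (+ 0 + k * + 2) * m  ≡⟨ solve (b ∷ k ∷ m ∷ []) ⟩
  b + k * (m + m)          ∎))
  where open ≡-Reasoning
... | 1 | k | _ | q≡1+2k = inj₂ (congruent k (begin
  a                        ≡⟨ eq ⟩
  b + q * m                ≡⟨ cong (λ q → b + q * m) q≡1+2k ⟩
  b + (+ 1 + k * + 2) * m  ≡⟨ solve (b ∷ k ∷ m ∷ []) ⟩
  b + m + k * (m + m)      ∎))
  where open ≡-Reasoning
... | suc (suc _) | _ | s≤s (s≤s ()) | _

half-shifts-mod : ∀ h {a b c} → a ≡ b + h mod h + h → b ≡ c + h mod h + h → a ≡ c mod h + h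
half-shifts-mod h {c = c} (congruent q refl) (congruent r refl) =
  congruent (q + r + 1ℤ) (solve (c ∷ h ∷ q ∷ r ∷ []))

*2-cancel-mod-even : ∀ h {a b} → + 2 * a ≡ + 2 * b mod h + h → a ≡ b mod h
*2-cancel-mod-even h {a} {b} (congruent q eq) =
  *-cancelˡ-mod (+ 2) (congruent q (trans eq (solve (b ∷ q ∷ h ∷ []))))

*2-cancel-mod-odd : ∀ h {a b} → + 2 * a ≡ + 2 * b mod 1ℤ + (h + h) → a ≡ b mod 1ℤ + (h + h)
*2-cancel-mod-odd h {a} {b} 2a≡2b = begin
  a                      ≈⟨ congruent (- a) (solve (h ∷ a ∷ [])) ⟩
  (1ℤ + h) * (+ 2 * a)   ≈⟨ *-congˡ-mod (1ℤ + h) 2a≡2b ⟩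
  (1ℤ + h) * (+ 2 * b)   ≈⟨ congruent b (solve (h ∷ b ∷ [])) ⟩
  b                      ∎
  where open ModReasoning (1ℤ + (h + h))

displace-flip : ∀ a s {b m} → b ≡ a + s mod m → a ≡ b + - s mod m
displace-flip a s {m = m} (congruent q refl) = congruent (- q) (solve (a ∷ s ∷ q ∷ m ∷ []))

displace-trans : ∀ a s t {b c m} → b ≡ a + s mod m → c ≡ b + t mod m → c ≡ a + (s + t) mod m
displace-trans a s t {m = m} (congruent q refl) (congruent r refl) =
  congruent (q + r) (solve (a ∷ s ∷ t ∷ q ∷ r ∷ m ∷ []))

self-displacement-mod : ∀ a s {m} → a ≡ a + s mod m → s ≡ 0ℤ mod m
self-displacement-mod a s {m} (congruent q eq) = congruent (- q) (begin
  s                              ≡⟨ solve (a ∷ s ∷ q ∷ m ∷ []) ⟩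
  (a + s + q * m) - a + - q * m  ≡⟨ cong (λ z → z - a + - q * m) eq ⟨
  a - a + - q * m                ≡⟨ solve (a ∷ q ∷ m ∷ []) ⟩
  0ℤ + - q * m                   ∎)
  where open ≡-Reasoning

reflect-mod : ∀ a a′ t {b b′ m} → a + a′ ≡ b + b′ mod m → b ≡ a + t mod m → b′ ≡ a′ + - t mod m
reflect-mod a a′ t {b′ = b′} {m} (congruent q eq) (congruent r refl) = congruent (- q - r) (begin
  b′                                                      ≡⟨ solve (a ∷ t ∷ r ∷ m ∷ b′ ∷ q ∷ []) ⟩
  (a + t + r * m) + b′ + q * m - (a + t + r * m) - q * m  ≡⟨ cong (λ z → z - (a + t + r * m) - q * m) eq ⟨
  a + a′ - (a + t + r * m) - q * m                        ≡⟨ solve (a ∷ a′ ∷ t ∷ q ∷ r ∷ m ∷ []) ⟩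
  a′ + - t + (- q - r) * m                                ∎)
  where open ≡-Reasoning

antipodal-mod : ∀ a h → (a + -1ℤ) + (a + 1ℤ) ≡ (a + h) + (a + h) mod h + h
antipodal-mod a h = congruent -1ℤ (solve (a ∷ h ∷ []))

midpoint-flip-mod : ∀ a s {b m} → b ≡ a + s mod m → + 2 * b + - s ≡ + 2 * a + s mod + 2 * m
midpoint-flip-mod a s {m = m} (congruent q refl) = congruent q (solve (a ∷ s ∷ q ∷ m ∷ []))

*2-displacement-mod : ∀ a t s {b m} → b ≡ a + t mod m → + 2 * b ≡ (+ 2 * a + s) + (+ 2 * t - s) mod + 2 * m
*2-displacement-mod a t s {m = m} (congruent q refl) = congruent q (solve (a ∷ t ∷ s ∷ q ∷ m ∷ []))

opposite-offsets-mod : ∀ p q s {a m} → a ≡ p + - s mod m → a ≡ q + s mod m → + 2 * a ≡ p + q mod m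
opposite-offsets-mod p q s {m = m} (congruent r refl) (congruent r′ eq) = congruent (r + r′) (begin
  + 2 * (p + - s + r * m)                ≡⟨ solve (p ∷ s ∷ r ∷ m ∷ []) ⟩
  (p + - s + r * m) + (p + - s + r * m)  ≡⟨ cong (λ z → p + - s + r * m + z) eq ⟩
  (p + - s + r * m) + (q + s + r′ * m)   ≡⟨ solve (p ∷ q ∷ s ∷ r ∷ r′ ∷ m ∷ []) ⟩
  p + q + (r + r′) * m                   ∎)
  where open ≡-Reasoning

n≡n%2+[n/2+n/2] : ∀ n → n ≡ n % 2 ℕ.+ (n ℕ./ 2 ℕ.+ n ℕ./ 2)
n≡n%2+[n/2+n/2] n = trans (ℕ.m≡m%n+[m/n]*n n 2) (cong (n % 2 ℕ.+_) (h*2≡h+h (n ℕ./ 2)))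
  where
  h*2≡h+h : ∀ h → h ℕ.* 2 ≡ h ℕ.+ h
  h*2≡h+h = ℕ-Solver.solve-∀

data IsUnit : ℤ → Set where
  one       : IsUnit 1ℤ
  minus-one : IsUnit -1ℤ

IsUnit-neg : ∀ {σ} → IsUnit σ → IsUnit (- σ)
IsUnit-neg one       = minus-one
IsUnit-neg minus-one = one

∣i+σ∣≤1+∣i∣ : ∀ {σ} → IsUnit σ → ∀ i → ∣ i + σ ∣ ≤ suc ∣ i ∣
∣i+σ∣≤1+∣i∣ one       i = ℕₚ.≤-trans (ℤₚ.∣i+j∣≤∣i∣+∣j∣ i 1ℤ) (ℕₚ.≤-reflexive (ℕₚ.+-comm ∣ i ∣ 1))
∣i+σ∣≤1+∣i∣ minus-one i = ℕₚ.≤-trans (ℤₚ.∣i+j∣≤∣i∣+∣j∣ i -1ℤ) (ℕₚ.≤-reflexive (ℕₚ.+-comm ∣ i ∣ 1))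

∣t-σ∣<∣t∣⊎∣2t-σ∣≡1+2∣t∣ : ∀ {σ} → IsUnit σ → ∀ t → ∣ t - σ ∣ < ∣ t ∣ ⊎ ∣ + 2 * t - σ ∣ ≡ suc (2 ℕ.* ∣ t ∣)
∣t-σ∣<∣t∣⊎∣2t-σ∣≡1+2∣t∣ one       (+ 0)     = inj₂ refl
∣t-σ∣<∣t∣⊎∣2t-σ∣≡1+2∣t∣ one       +[1+ k ]  = inj₁ ℕₚ.≤-refl
∣t-σ∣<∣t∣⊎∣2t-σ∣≡1+2∣t∣ one       -[1+ k ]  = inj₂ (begin
  ∣ + 2 * -[1+ k ] - 1ℤ ∣              ≡⟨⟩
  suc (suc (k ℕ.+ 1 ℕ.* suc k ℕ.+ 0))  ≡⟨ ℕ-Solver.solve (k ∷ []) ⟩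
  suc (2 ℕ.* suc k)                    ∎)
  where open ≡-Reasoning
∣t-σ∣<∣t∣⊎∣2t-σ∣≡1+2∣t∣ minus-one (+ 0)     = inj₂ refl
∣t-σ∣<∣t∣⊎∣2t-σ∣≡1+2∣t∣ minus-one +[1+ k ]  = inj₂ (begin
  ∣ + 2 * +[1+ k ] - -1ℤ ∣             ≡⟨⟩
  suc (k ℕ.+ 1 ℕ.* suc k ℕ.+ 1)        ≡⟨ ℕ-Solver.solve (k ∷ []) ⟩
  suc (2 ℕ.* suc k)                    ∎)
  where open ≡-Reasoning
∣t-σ∣<∣t∣⊎∣2t-σ∣≡1+2∣t∣ minus-one -[1+ k ]  = inj₁ (ℕₚ.≤-reflexive (cong suc (ℤₚ.∣⊖∣-≤ (s≤s z≤n))))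

∣i∣≡∣j∣⇒i≡±j : ∀ i j → ∣ i ∣ ≡ ∣ j ∣ → i ≡ j ⊎ i ≡ - j
∣i∣≡∣j∣⇒i≡±j (+ a)    (+ b)    eq   = inj₁ (cong +_ eq)
∣i∣≡∣j∣⇒i≡±j -[1+ a ] -[1+ b ] eq   = inj₁ (cong -[1+_] (ℕₚ.suc-injective eq))
∣i∣≡∣j∣⇒i≡±j (+ a)    -[1+ b ] eq   = inj₂ (cong +_ eq)
∣i∣≡∣j∣⇒i≡±j -[1+ a ] (+ b)    refl = inj₂ refl

-- Reachability, distances and resolution

∨-introˡ : ∀ {a b} → T a → T (a ∨ b)
∨-introˡ {true} t = t

∨-introʳ : ∀ {a b} → T b → T (a ∨ b)
∨-introʳ {true}  _ = tt
∨-introʳ {false} t = t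

∧-intro : ∀ {a b} → T a → T b → T (a ∧ b)
∧-intro {true} _ t = t

anyFin-witness : ∀ {m} (f : Fin m → Bool) → T (anyFin f) → ∃ λ x → T (f x)
anyFin-witness {suc m} f any with Equivalence.to Boolₚ.T-∨ any
... | inj₁ f0   = fzero , f0
... | inj₂ any′ = Product.map fsuc id (anyFin-witness (f ∘ fsuc) any′)

anyFin-intro : ∀ {m} (f : Fin m → Bool) x → T (f x) → T (anyFin f)
anyFin-intro f fzero    fx = ∨-introˡ fx
anyFin-intro f (fsuc x) fx = ∨-introʳ {f fzero} (anyFin-intro (f ∘ fsuc) x fx)

module _ {m} (G : Graph m) (k : ℕ) (u w : Fin m) where

  reach-suc-cases : T (reach G (suc k) u w) → T (reach G k u w) ⊎ ∃ λ x → T (reach G k u x) × T (G x w)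
  reach-suc-cases r with Equivalence.to Boolₚ.T-∨ r
  ... | inj₁ r′ = inj₁ r′
  ... | inj₂ r′ with anyFin-witness _ r′
  ...   | x , rx = inj₂ (x , Equivalence.to Boolₚ.T-∧ rx)

  reach-stay : T (reach G k u w) → T (reach G (suc k) u w)
  reach-stay = ∨-introˡ

  reach-step : ∀ x → T (reach G k u x) → T (G x w) → T (reach G (suc k) u w)
  reach-step x r a = ∨-introʳ {reach G k u w} (anyFin-intro _ x (∧-intro r a))

firstTrue-≤ : ∀ (p : ℕ → Bool) b k → T (p k) → firstTrue p b ≤ k
firstTrue-≤ p zero    k       _  = z≤n
firstTrue-≤ p (suc b) k       pk with p zero in p0
... | true                              = z≤n
firstTrue-≤ p (suc b) zero    pk | false = ⊥-elim (subst T p0 pk)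
firstTrue-≤ p (suc b) (suc k) pk | false = s≤s (firstTrue-≤ (p ∘ suc) b k pk)

firstTrue-holds : ∀ (p : ℕ → Bool) b k → k < b → T (p k) → T (p (firstTrue p b))
firstTrue-holds p (suc b) k       _         pk with p zero in p0
... | true                                          = subst T (sym p0) tt
firstTrue-holds p (suc b) zero    _         pk | false = ⊥-elim (subst T p0 pk)
firstTrue-holds p (suc b) (suc k) (s≤s k<b) pk | false = firstTrue-holds (p ∘ suc) b k k<b pk

unresolved⇒equidistant : ∀ {m} (G : Graph m) e₁ e₂ v → ¬ T (inR G e₁ e₂ v) → edgeDist G e₁ v ≡ edgeDist G e₂ v
unresolved⇒equidistant G e₁ e₂ v unresolved with edgeDist G e₁ v ≡ᵇ edgeDist G e₂ v in eq
... | true  = ℕₚ.≡ᵇ⇒≡ _ _ (subst T (sym eq) tt)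
... | false = ⊥-elim (unresolved tt)

equidistant⇒unresolved : ∀ {m} (G : Graph m) e₁ e₂ v → edgeDist G e₁ v ≡ edgeDist G e₂ v → ¬ T (inR G e₁ e₂ v)
equidistant⇒unresolved G e₁ e₂ v equidistant with edgeDist G e₁ v ≡ᵇ edgeDist G e₂ v in eq
... | true  = λ ()
... | false = λ _ → subst T eq (ℕₚ.≡⇒≡ᵇ _ _ equidistant)

singleton-unresolved : ∀ {m} (G : Graph m) e₁ e₂ y → ¬ T (inR G e₁ e₂ y) →
                       ∀ v → T (does (v Finₚ.≟ y)) → ¬ T (inR G e₁ e₂ v)
singleton-unresolved G e₁ e₂ y y-unresolved v v≡y with v Finₚ.≟ y
... | yes refl = y-unresolved

-- Rational weights

module ℚ-Sum = SemiringSum (CommutativeRing.semiring ℚₚ.+-*-commutativeRing)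
open SemiringMult (CommutativeRing.semiring ℚₚ.+-*-commutativeRing)
  using (×-homo-+; ×-assoc-*; ×-comm-*) renaming (_×_ to _·_)

sumFin≡sum : ∀ {m} (f : Fin m → ℚ) → sumFin f ≡ ℚ-Sum.sum f
sumFin≡sum {zero}  f = refl
sumFin≡sum {suc m} f = cong (f fzero ℚ.+_) (sumFin≡sum (f ∘ fsuc))

sumFin-cong : ∀ {m} {f g : Fin m → ℚ} → (∀ i → f i ≡ g i) → sumFin f ≡ sumFin g
sumFin-cong {zero}  f≗g = refl
sumFin-cong {suc m} f≗g = cong₂ ℚ._+_ (f≗g fzero) (sumFin-cong (f≗g ∘ fsuc))

sumFin-mono-≤ : ∀ {m} {f g : Fin m → ℚ} → (∀ i → f i ℚ.≤ g i) → sumFin f ℚ.≤ sumFin g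
sumFin-mono-≤ {zero}  f≤g = ℚₚ.≤-refl
sumFin-mono-≤ {suc m} f≤g = ℚₚ.+-mono-≤ (f≤g fzero) (sumFin-mono-≤ (f≤g ∘ fsuc))

sumFin-const : ∀ m x → sumFin {m} (λ _ → x) ≡ m · x
sumFin-const zero    x = refl
sumFin-const (suc m) x = cong (x ℚ.+_) (sumFin-const m x)

sumFin-zero : ∀ m → sumFin {m} (λ _ → 0ℚ) ≡ 0ℚ
sumFin-zero m = trans (sumFin≡sum {m} (λ _ → 0ℚ)) (ℚ-Sum.sum-replicate-zero m)

sumFin-+ : ∀ {m} (f g : Fin m → ℚ) → sumFin (λ i → f i ℚ.+ g i) ≡ sumFin f ℚ.+ sumFin g
sumFin-+ f g = begin
  sumFin (λ i → f i ℚ.+ g i)     ≡⟨ sumFin≡sum (λ i → f i ℚ.+ g i) ⟩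
  ℚ-Sum.sum (λ i → f i ℚ.+ g i)  ≡⟨ ℚ-Sum.∑-distrib-+ f g ⟩
  ℚ-Sum.sum f ℚ.+ ℚ-Sum.sum g    ≡⟨ cong₂ ℚ._+_ (sumFin≡sum f) (sumFin≡sum g) ⟨
  sumFin f ℚ.+ sumFin g          ∎
  where open ≡-Reasoning

sumFin-permute : ∀ {m} (g : Fin m → ℚ) (π : Permutation′ m) → sumFin (g ∘ (π ⟨$⟩ʳ_)) ≡ sumFin g
sumFin-permute g π = begin
  sumFin (g ∘ (π ⟨$⟩ʳ_))     ≡⟨ sumFin≡sum (g ∘ (π ⟨$⟩ʳ_)) ⟩
  ℚ-Sum.sum (g ∘ (π ⟨$⟩ʳ_))  ≡⟨ ℚ-Sum.sum-permute g π ⟨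
  ℚ-Sum.sum g                   ≡⟨ sumFin≡sum g ⟨
  sumFin g                      ∎
  where open ≡-Reasoning

+-cancelʳ-≤ : ∀ r {p q} → p ℚ.+ r ℚ.≤ q ℚ.+ r → p ℚ.≤ q
+-cancelʳ-≤ r {p} {q} p+r≤q+r = subst₂ ℚ._≤_ (cancel p) (cancel q) (ℚₚ.+-monoˡ-≤ (ℚ.- r) p+r≤q+r)
  where
  cancel : ∀ x → x ℚ.+ r ℚ.- r ≡ x
  cancel x = trans (ℚₚ.+-assoc x r (ℚ.- r)) (trans (cong (x ℚ.+_) (ℚₚ.+-inverseʳ r)) (ℚₚ.+-identityʳ x))

·-nonNeg : ∀ {x} → 0ℚ ℚ.≤ x → ∀ k → 0ℚ ℚ.≤ k · x
·-nonNeg     0≤x zero    = ℚₚ.≤-refl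
·-nonNeg {x} 0≤x (suc k) = subst (ℚ._≤ x ℚ.+ k · x) (ℚₚ.+-identityʳ 0ℚ) (ℚₚ.+-mono-≤ 0≤x (·-nonNeg 0≤x k))

·-monoˡ-≤ : ∀ {x} → 0ℚ ℚ.≤ x → ∀ {k l} → k ≤ l → k · x ℚ.≤ l · x
·-monoˡ-≤     0≤x {l = l} z≤n       = ·-nonNeg 0≤x l
·-monoˡ-≤ {x} 0≤x         (s≤s k≤l) = ℚₚ.+-monoʳ-≤ x (·-monoˡ-≤ 0≤x k≤l)

toℚᵘ-/ : ∀ i d → ℚ.toℚᵘ (i / suc d) ℚᵘ.≃ ℚᵘ.mkℚᵘ i d
toℚᵘ-/ i d = ℚₚ.toℚᵘ-fromℚᵘ (ℚᵘ.mkℚᵘ i d)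

mkℚᵘ-+ : ∀ i j d → ℚᵘ.mkℚᵘ i d ℚᵘ.+ ℚᵘ.mkℚᵘ j d ℚᵘ.≃ ℚᵘ.mkℚᵘ (i + j) d
mkℚᵘ-+ i j d = ℚᵘ.*≡* (trans (distrib i j (+ suc d)) (cong ((i + j) *_) (sym (ℤₚ.pos-* (suc d) (suc d)))))
  where
  distrib : ∀ i j e → (i * e + j * e) * e ≡ (i + j) * (e * e)
  distrib = solve-∀

/-+ : ∀ i j d → i / suc d ℚ.+ j / suc d ≡ (i + j) / suc d
/-+ i j d = ℚₚ.toℚᵘ-injective (begin
  ℚ.toℚᵘ (i / suc d ℚ.+ j / suc d)            ≈⟨ ℚₚ.toℚᵘ-homo-+ (i / suc d) (j / suc d) ⟩
  ℚ.toℚᵘ (i / suc d) ℚᵘ.+ ℚ.toℚᵘ (j / suc d)  ≈⟨ ℚᵘₚ.+-cong (toℚᵘ-/ i d) (toℚᵘ-/ j d) ⟩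
  ℚᵘ.mkℚᵘ i d ℚᵘ.+ ℚᵘ.mkℚᵘ j d                ≈⟨ mkℚᵘ-+ i j d ⟩
  ℚᵘ.mkℚᵘ (i + j) d                           ≈⟨ toℚᵘ-/ (i + j) d ⟨
  ℚ.toℚᵘ ((i + j) / suc d)                    ∎)
  where open ℚᵘₚ.≃-Reasoning

n/n≡1 : ∀ d → + suc d / suc d ≡ 1ℚ
n/n≡1 d = ℚₚ.toℚᵘ-injective (ℚᵘₚ.≃-trans (toℚᵘ-/ (+ suc d) d) (ℚᵘ.*≡* (ℤₚ.*-comm (+ suc d) (+ 1))))

·-1/n≡k/n : ∀ k d → k · (+ 1 / suc d) ≡ + k / suc d
·-1/n≡k/n zero    d = sym (ℚₚ.0/n≡0 (suc d))
·-1/n≡k/n (suc k) d = trans (cong (+ 1 / suc d ℚ.+_) (·-1/n≡k/n k d)) (/-+ (+ 1) (+ k) d)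

n·1/n≡1 : ∀ d → suc d · (+ 1 / suc d) ≡ 1ℚ
n·1/n≡1 d = trans (·-1/n≡k/n (suc d) d) (n/n≡1 d)

1/n-nonNeg : ∀ d → 0ℚ ℚ.≤ + 1 / suc d
1/n-nonNeg d = ℚₚ.nonNegative⁻¹ (+ 1 / suc d) {{ℚₚ.normalize-nonNeg 1 (suc d)}}

1/n≤1 : ∀ d → + 1 / suc d ℚ.≤ 1ℚ
1/n≤1 d = begin
  + 1 / suc d            ≡⟨ ℚₚ.+-identityʳ (+ 1 / suc d) ⟨
  1 · (+ 1 / suc d)      ≤⟨ ·-monoˡ-≤ (1/n-nonNeg d) {1} {suc d} (s≤s z≤n) ⟩
  suc d · (+ 1 / suc d)  ≡⟨ n·1/n≡1 d ⟩
  1ℚ                     ∎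
  where open ℚₚ.≤-Reasoning

m·1≤n·S⇒m/n≤S : ∀ m d {S} → m · 1ℚ ℚ.≤ suc d · S → + m / suc d ℚ.≤ S
m·1≤n·S⇒m/n≤S m d {S} m≤[1+d]S = begin
  + m / suc d         ≡⟨ ·-1/n≡k/n m d ⟨
  m · c               ≡⟨ cong (m ·_) (ℚₚ.*-identityˡ c) ⟨
  m · (1ℚ ℚ.* c)      ≡⟨ ×-assoc-* m 1ℚ c ⟨
  (m · 1ℚ) ℚ.* c      ≤⟨ ℚₚ.*-monoʳ-≤-nonNeg c {{ℚₚ.normalize-nonNeg 1 (suc d)}} m≤[1+d]S ⟩
  (suc d · S) ℚ.* c   ≡⟨ ×-assoc-* (suc d) S c ⟩
  suc d · (S ℚ.* c)   ≡⟨ ×-comm-* (suc d) S c ⟨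
  S ℚ.* (suc d · c)   ≡⟨ cong (S ℚ.*_) (n·1/n≡1 d) ⟩
  S ℚ.* 1ℚ            ≡⟨ ℚₚ.*-identityʳ S ⟩
  S                   ∎
  where
  open ℚₚ.≤-Reasoning
  c : ℚ
  c = + 1 / suc d

count : ∀ {m} → (Fin m → Bool) → ℕ
count {zero}  U = 0
count {suc m} U = (if U fzero then 1 else 0) ℕ.+ count (U ∘ fsuc)

count-all : ∀ {m} (U : Fin m → Bool) → (∀ v → T (U v)) → count U ≡ m
count-all {zero}  U all = refl
count-all {suc m} U all with U fzero | all fzero
... | true  | _  = cong suc (count-all (U ∘ fsuc) (all ∘ fsuc))
... | false | ()

count-≥-∸1 : ∀ {m} (U : Fin m → Bool) → (∀ v w → ¬ T (U v) → ¬ T (U w) → v ≡ w) → m ∸ 1 ≤ count U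
count-≥-∸1 {zero}  U unique = z≤n
count-≥-∸1 {suc m} U unique with U fzero in U0
... | true  = ℕₚ.≤-trans (ℕₚ.m≤n+m∸n m 1) (s≤s (count-≥-∸1 (U ∘ fsuc) λ v w v∉U w∉U →
                Finₚ.suc-injective (unique (fsuc v) (fsuc w) v∉U w∉U)))
... | false = ℕₚ.≤-reflexive (sym (count-all (U ∘ fsuc) others))
  where
  others : ∀ v → T (U (fsuc v))
  others v with U (fsuc v) in U1
  ... | true  = tt
  ... | false with () ← unique fzero (fsuc v) (subst T U0) (subst T U1)

count-≥-∸2 : ∀ {m} (U : Fin m → Bool) →
             (∀ u v w → ¬ T (U u) → ¬ T (U v) → ¬ T (U w) → u ≡ v ⊎ u ≡ w ⊎ v ≡ w) → m ∸ 2 ≤ count U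
count-≥-∸2 {zero}  U two = z≤n
count-≥-∸2 {suc m} U two with U fzero in U0
... | true  = ℕₚ.≤-trans (suc∸2≤suc[∸2] m) (s≤s (count-≥-∸2 (U ∘ fsuc) λ u v w u∉U v∉U w∉U →
                Sum.map Finₚ.suc-injective (Sum.map Finₚ.suc-injective Finₚ.suc-injective)
                  (two (fsuc u) (fsuc v) (fsuc w) u∉U v∉U w∉U)))
  where
  suc∸2≤suc[∸2] : ∀ m → suc m ∸ 2 ≤ suc (m ∸ 2)
  suc∸2≤suc[∸2] zero    = z≤n
  suc∸2≤suc[∸2] (suc m) = ℕₚ.m≤n+m∸n m 1
... | false = count-≥-∸1 (U ∘ fsuc) λ v w v∉U w∉U →
                Finₚ.suc-injective (fsuc-pair (two fzero (fsuc v) (fsuc w) (subst T U0) v∉U w∉U))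
  where
  fsuc-pair : ∀ {v w} → fzero ≡ fsuc v ⊎ fzero ≡ fsuc w ⊎ fsuc v ≡ fsuc w → fsuc {m} v ≡ fsuc w
  fsuc-pair (inj₁ ())
  fsuc-pair (inj₂ (inj₁ ()))
  fsuc-pair (inj₂ (inj₂ v≡w)) = v≡w

weight-const : ∀ {m} c (U : Fin m → Bool) → weight (λ _ → c) U ≡ count U · c
weight-const {zero}  c U = refl
weight-const {suc m} c U with U fzero
... | true  = cong (c ℚ.+_) (weight-const c (U ∘ fsuc))
... | false = trans (ℚₚ.+-identityˡ _) (weight-const c (U ∘ fsuc))

weight-singleton : ∀ {m} (g : Fin m → ℚ) j → weight g (λ v → does (v Finₚ.≟ j)) ≡ g j
weight-singleton {suc m} g fzero    = trans (cong (g fzero ℚ.+_) (sumFin-zero m)) (ℚₚ.+-identityʳ (g fzero))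
weight-singleton {suc m} g (fsuc j) = trans (ℚₚ.+-identityˡ _) (weight-singleton (g ∘ fsuc) j)

weight-∨ : ∀ {m} (g : Fin m → ℚ) {U U′ : Fin m → Bool} → (∀ v → T (U v) → ¬ T (U′ v)) →
           weight g (λ v → U v ∨ U′ v) ≡ weight g U ℚ.+ weight g U′
weight-∨ g {U} {U′} disjoint =
  trans (sumFin-cong pointwise) (sumFin-+ (λ v → if U v then g v else 0ℚ) (λ v → if U′ v then g v else 0ℚ))
  where
  pointwise : ∀ v → (if U v ∨ U′ v then g v else 0ℚ) ≡ (if U v then g v else 0ℚ) ℚ.+ (if U′ v then g v else 0ℚ)
  pointwise v with U v in Uv | U′ v in U′v
  ... | true  | true  = ⊥-elim (disjoint v (subst T (sym Uv) tt) (subst T (sym U′v) tt))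
  ... | true  | false = sym (ℚₚ.+-identityʳ (g v))
  ... | false | true  = sym (ℚₚ.+-identityˡ (g v))
  ... | false | false = sym (ℚₚ.+-identityˡ 0ℚ)

weight≤sumFin : ∀ {m} (g : Fin m → ℚ) (U : Fin m → Bool) → (∀ v → 0ℚ ℚ.≤ g v) → weight g U ℚ.≤ sumFin g
weight≤sumFin g U g≥0 = sumFin-mono-≤ pointwise
  where
  pointwise : ∀ v → (if U v then g v else 0ℚ) ℚ.≤ g v
  pointwise v with U v
  ... | true  = ℚₚ.≤-refl
  ... | false = g≥0 v

constant-edge-resolving : ∀ {m} (G : Graph m) d →
  (∀ e₁ e₂ → DistinctEdges {G = G} e₁ e₂ → suc d ≤ count (inR G e₁ e₂)) →
  Σ (Fin m → ℚ) λ g → IsEdgeResolving G g × weight g (λ _ → true) ≡ + m / suc d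
constant-edge-resolving {m} G d resolved-by-many =
  (λ _ → c) , ((λ _ → 1/n-nonNeg d , 1/n≤1 d) , resolves) , trans (sumFin-const m c) (·-1/n≡k/n m d)
  where
  c : ℚ
  c = + 1 / suc d
  resolves : ∀ e₁ e₂ → DistinctEdges {G = G} e₁ e₂ → 1ℚ ℚ.≤ weight (λ _ → c) (inR G e₁ e₂)
  resolves e₁ e₂ e₁≢e₂ = begin
    1ℚ                              ≡⟨ n·1/n≡1 d ⟨
    suc d · c                       ≤⟨ ·-monoˡ-≤ (1/n-nonNeg d) (resolved-by-many e₁ e₂ e₁≢e₂) ⟩
    count (inR G e₁ e₂) · c         ≡⟨ weight-const c (inR G e₁ e₂) ⟨
    weight (λ _ → c) (inR G e₁ e₂)  ∎
    where open ℚₚ.≤-Reasoning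

blind-weight-bound : ∀ {m} (G : Graph m) {g} → IsEdgeResolving G g →
  ∀ e₁ e₂ → DistinctEdges {G = G} e₁ e₂ → (B : Fin m → Bool) → (∀ v → T (B v) → ¬ T (inR G e₁ e₂ v)) →
  1ℚ ℚ.+ weight g B ℚ.≤ sumFin g
blind-weight-bound {m} G {g} (g∈[0,1] , resolving) e₁ e₂ e₁≢e₂ B blind = begin
  1ℚ ℚ.+ weight g B           ≤⟨ ℚₚ.+-monoˡ-≤ (weight g B) (resolving e₁ e₂ e₁≢e₂) ⟩
  weight g R ℚ.+ weight g B   ≡⟨ weight-∨ g (λ v r b → blind v b r) ⟨
  weight g (λ v → R v ∨ B v)  ≤⟨ weight≤sumFin g _ (proj₁ ∘ g∈[0,1]) ⟩
  sumFin g                    ∎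
  where
  open ℚₚ.≤-Reasoning
  R : Fin m → Bool
  R = inR G e₁ e₂

averaging-bound : ∀ k d {S} (f : Fin (k ℕ.+ suc d) → ℚ) →
                  (∀ i → 1ℚ ℚ.+ f i ℚ.≤ S) → sumFin f ≡ k · S → + (k ℕ.+ suc d) / suc d ℚ.≤ S
averaging-bound k d {S} f 1+f≤S Σf≡kS = m·1≤n·S⇒m/n≤S m d (+-cancelʳ-≤ (k · S) (begin
  m · 1ℚ ℚ.+ k · S                    ≡⟨ cong₂ ℚ._+_ (sumFin-const m 1ℚ) Σf≡kS ⟨
  sumFin {m} (λ _ → 1ℚ) ℚ.+ sumFin f  ≡⟨ sumFin-+ (λ _ → 1ℚ) f ⟨
  sumFin (λ i → 1ℚ ℚ.+ f i)           ≤⟨ sumFin-mono-≤ 1+f≤S ⟩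
  sumFin {m} (λ _ → S)                ≡⟨ sumFin-const m S ⟩
  (k ℕ.+ suc d) · S                   ≡⟨ ×-homo-+ S k (suc d) ⟩
  k · S ℚ.+ suc d · S                 ≡⟨ ℚₚ.+-comm (k · S) (suc d · S) ⟩
  suc d · S ℚ.+ k · S                 ∎))
  where
  open ℚₚ.≤-Reasoning
  m : ℕ
  m = k ℕ.+ suc d

-- The cycle C_n

module Cycle (n : ℕ) .{{_ : ℕ.NonZero n}} where

  C : Graph n
  C = cycle n

  ⟦_⟧ : Fin n → ℤ
  ⟦ x ⟧ = + toℕ x

  ⟦⟧-injective-mod : ∀ {x y} → ⟦ x ⟧ ≡ ⟦ y ⟧ mod + n → x ≡ y
  ⟦⟧-injective-mod {x} {y} = Finₚ.toℕ-injective ∘ +-mod-bounded⇒≡ (Finₚ.toℕ<n x) (Finₚ.toℕ<n y)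

  residue : ℤ → Fin n
  residue z = Fin.fromℕ< (ℤ.n%ℕd<d z n)

  ⟦residue⟧ : ∀ z → ⟦ residue z ⟧ ≡ z mod + n
  ⟦residue⟧ z = mod-sym (congruent (z ℤ./ℕ n) (begin
    z                               ≡⟨ ℤ.a≡a%ℕn+[a/ℕn]*n z n ⟩
    + (z ℤ.%ℕ n) + z ℤ./ℕ n * + n   ≡⟨ cong (λ r → + r + z ℤ./ℕ n * + n) (Finₚ.toℕ-fromℕ< _) ⟨
    ⟦ residue z ⟧ + z ℤ./ℕ n * + n  ∎))
    where open ≡-Reasoning

  record Step (x y : Fin n) : Set where
    constructor step
    field
      {σ}   : ℤ
      unit  : IsUnit σ
      y≡x+σ : ⟦ y ⟧ ≡ ⟦ x ⟧ + σ mod + n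

  Step-flip : ∀ {x y} → Step x y → Step y x
  Step-flip {x} (step {σ} unit y≡x+σ) = step (IsUnit-neg unit) (displace-flip ⟦ x ⟧ σ y≡x+σ)

  -- The two clauses of cycle in which b follows a.
  Successor : ℕ → ℕ → Set
  Successor a b = suc a ≡ b ⊎ (b ≡ 0 × suc a ≡ n)

  adjacent⇒successor : ∀ {x y} → T (C x y) → Successor (toℕ x) (toℕ y) ⊎ Successor (toℕ y) (toℕ x)
  adjacent⇒successor adj with Equivalence.to Boolₚ.T-∨ adj
  ... | inj₁ x→y = inj₁ (inj₁ (ℕₚ.≡ᵇ⇒≡ _ _ x→y))
  ... | inj₂ adj′ with Equivalence.to Boolₚ.T-∨ adj′
  ...   | inj₁ y→x = inj₂ (inj₁ (ℕₚ.≡ᵇ⇒≡ _ _ y→x))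
  ...   | inj₂ adj″ with Equivalence.to Boolₚ.T-∨ adj″
  ...     | inj₁ y→x = inj₂ (inj₂ (Product.map (ℕₚ.≡ᵇ⇒≡ _ _) (ℕₚ.≡ᵇ⇒≡ _ _) (Equivalence.to Boolₚ.T-∧ y→x)))
  ...     | inj₂ x→y = inj₁ (inj₂ (Product.map (ℕₚ.≡ᵇ⇒≡ _ _) (ℕₚ.≡ᵇ⇒≡ _ _) (Equivalence.to Boolₚ.T-∧ x→y)))

  -- T is not injective, so the clauses of cycle that are skipped have to be named.
  successor⇒adjacent : ∀ {x y} → Successor (toℕ x) (toℕ y) ⊎ Successor (toℕ y) (toℕ x) → T (C x y)
  successor⇒adjacent (inj₁ (inj₁ x→y)) = ∨-introˡ (ℕₚ.≡⇒≡ᵇ _ _ x→y)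
  successor⇒adjacent {x} {y} (inj₂ (inj₁ y→x)) =
    ∨-introʳ {suc (toℕ x) ≡ᵇ toℕ y} (∨-introˡ (ℕₚ.≡⇒≡ᵇ _ _ y→x))
  successor⇒adjacent {x} {y} (inj₂ (inj₂ (x≡0 , y→n))) =
    ∨-introʳ {suc (toℕ x) ≡ᵇ toℕ y} (∨-introʳ {suc (toℕ y) ≡ᵇ toℕ x}
      (∨-introˡ (∧-intro (ℕₚ.≡⇒≡ᵇ _ _ x≡0) (ℕₚ.≡⇒≡ᵇ _ _ y→n))))
  successor⇒adjacent {x} {y} (inj₁ (inj₂ (y≡0 , x→n))) =
    ∨-introʳ {suc (toℕ x) ≡ᵇ toℕ y} (∨-introʳ {suc (toℕ y) ≡ᵇ toℕ x}
      (∨-introʳ {(toℕ x ≡ᵇ 0) ∧ (suc (toℕ y) ≡ᵇ n)} (∧-intro (ℕₚ.≡⇒≡ᵇ _ _ y≡0) (ℕₚ.≡⇒≡ᵇ _ _ x→n))))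

  successor⇒+1 : ∀ {x y} → Successor (toℕ x) (toℕ y) → ⟦ y ⟧ ≡ ⟦ x ⟧ + 1ℤ mod + n
  successor⇒+1 {x} (inj₁ x→y) = mod-reflexive (trans (cong +_ (sym x→y)) (cong +_ (ℕₚ.+-comm 1 (toℕ x))))
  successor⇒+1 {x} {y} (inj₂ (y≡0 , x→n)) = begin
    ⟦ y ⟧       ≡⟨ cong +_ y≡0 ⟩
    0ℤ          ≈⟨ modulus≡0 ⟨
    + n         ≡⟨ cong +_ (trans (sym x→n) (ℕₚ.+-comm 1 (toℕ x))) ⟩
    ⟦ x ⟧ + 1ℤ  ∎
    where open ModReasoning (+ n)

  +1⇒successor : ∀ {x y} → ⟦ y ⟧ ≡ ⟦ x ⟧ + 1ℤ mod + n → Successor (toℕ x) (toℕ y)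
  +1⇒successor {x} {y} y≡x+1 with ℕₚ.m≤n⇒m<n∨m≡n (Finₚ.toℕ<n x)
  ... | inj₁ x+1<n = inj₁ (+-mod-bounded⇒≡ x+1<n (Finₚ.toℕ<n y) (begin
    + suc (toℕ x)  ≡⟨ cong +_ (ℕₚ.+-comm 1 (toℕ x)) ⟩
    ⟦ x ⟧ + 1ℤ     ≈⟨ y≡x+1 ⟨
    ⟦ y ⟧          ∎))
    where open ModReasoning (+ n)
  ... | inj₂ x+1≡n = inj₂ (+-mod-bounded⇒≡ (Finₚ.toℕ<n y) (ℕₚ.≤-<-trans z≤n (Finₚ.toℕ<n x)) (begin
    ⟦ y ⟧          ≈⟨ y≡x+1 ⟩
    ⟦ x ⟧ + 1ℤ     ≡⟨ cong +_ (trans (ℕₚ.+-comm (toℕ x) 1) x+1≡n) ⟩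
    + n            ≈⟨ modulus≡0 ⟩
    0ℤ             ∎) , x+1≡n)
    where open ModReasoning (+ n)

  adjacent⇒Step : ∀ {x y} → T (C x y) → Step x y
  adjacent⇒Step adj with adjacent⇒successor adj
  ... | inj₁ x→y = step one (successor⇒+1 x→y)
  ... | inj₂ y→x = Step-flip (step one (successor⇒+1 y→x))

  Step⇒adjacent : ∀ {x y} → Step x y → T (C x y)
  Step⇒adjacent   (step one       y≡x+1) = successor⇒adjacent (inj₁ (+1⇒successor y≡x+1))
  Step⇒adjacent s@(step minus-one _)     = successor⇒adjacent (inj₂ (+1⇒successor (Step.y≡x+σ (Step-flip s))))

  reach⇒displacement : ∀ k u w → T (reach C k u w) → ∃ λ t → ∣ t ∣ ≤ k × ⟦ w ⟧ ≡ ⟦ u ⟧ + t mod + n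
  reach⇒displacement zero u w u≟w with toWitness u≟w
  ... | refl = 0ℤ , z≤n , mod-reflexive (sym (ℤₚ.+-identityʳ ⟦ u ⟧))
  reach⇒displacement (suc k) u w r with reach-suc-cases C k u w r
  ... | inj₁ r′ = Product.map₂ (Product.map₁ ℕₚ.m≤n⇒m≤1+n) (reach⇒displacement k u w r′)
  ... | inj₂ (x , r′ , adj) with reach⇒displacement k u x r′ | adjacent⇒Step adj
  ...   | t , ∣t∣≤k , x≡u+t | step {σ} unit w≡x+σ =
    t + σ , ℕₚ.≤-trans (∣i+σ∣≤1+∣i∣ unit t) (s≤s ∣t∣≤k) , displace-trans ⟦ u ⟧ t σ x≡u+t w≡x+σ

  displacement⇒reach : ∀ k u w t → ∣ t ∣ ≤ k → ⟦ w ⟧ ≡ ⟦ u ⟧ + t mod + n → T (reach C k u w)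
  reach-via : ∀ k u w t t′ {σ} → IsUnit σ → t ≡ t′ + σ → ∣ t′ ∣ ≤ k → ⟦ w ⟧ ≡ ⟦ u ⟧ + t mod + n →
              T (reach C (suc k) u w)

  displacement⇒reach zero    u w (+ 0) _ w≡u+0 =
    fromWitness (⟦⟧-injective-mod (mod-sym (mod-trans w≡u+0 (mod-reflexive (ℤₚ.+-identityʳ ⟦ u ⟧)))))
  displacement⇒reach (suc k) u w (+ 0) _ w≡u+0 = reach-stay C k u w (displacement⇒reach k u w (+ 0) z≤n w≡u+0)
  displacement⇒reach (suc k) u w t@(+[1+ j ]) (s≤s j≤k) w≡u+t =
    reach-via k u w t (+ j) one (cong +_ (ℕₚ.+-comm 1 j)) j≤k w≡u+t
  displacement⇒reach (suc k) u w t@(-[1+ j ]) (s≤s j≤k) w≡u+t =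
    reach-via k u w t (- + j) minus-one (trans (ℤₚ.neg-suc j) (ℤₚ.+-comm -1ℤ (- + j)))
      (ℕₚ.≤-trans (ℕₚ.≤-reflexive (ℤₚ.∣-i∣≡∣i∣ (+ j))) j≤k) w≡u+t

  reach-via k u w t t′ {σ} unit t≡t′+σ ∣t′∣≤k w≡u+t =
    reach-step C k u w x (displacement⇒reach k u x t′ ∣t′∣≤k (⟦residue⟧ (⟦ u ⟧ + t′))) (Step⇒adjacent (step unit w≡x+σ))
    where
    x : Fin n
    x = residue (⟦ u ⟧ + t′)
    w≡x+σ : ⟦ w ⟧ ≡ ⟦ x ⟧ + σ mod + n
    w≡x+σ = begin
      ⟦ w ⟧             ≈⟨ w≡u+t ⟩
      ⟦ u ⟧ + t         ≡⟨ cong (λ t → ⟦ u ⟧ + t) t≡t′+σ ⟩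
      ⟦ u ⟧ + (t′ + σ)  ≡⟨ ℤₚ.+-assoc ⟦ u ⟧ t′ σ ⟨
      ⟦ u ⟧ + t′ + σ    ≈⟨ +-cong-mod (⟦residue⟧ (⟦ u ⟧ + t′)) mod-refl ⟨
      ⟦ x ⟧ + σ         ∎
      where open ModReasoning (+ n)

  dist-≤ : ∀ u w t → ⟦ w ⟧ ≡ ⟦ u ⟧ + t mod + n → dist C u w ≤ ∣ t ∣
  dist-≤ u w t w≡u+t = firstTrue-≤ (λ k → reach C k u w) n ∣ t ∣ (displacement⇒reach ∣ t ∣ u w t ℕₚ.≤-refl w≡u+t)

  dist-reached : ∀ u w → T (reach C (dist C u w) u w)
  dist-reached u w = firstTrue-holds (λ k → reach C k u w) n ∣ ⟦ w ⟧ - ⟦ u ⟧ ∣ (∣+a-+b∣<n (Finₚ.toℕ<n w) (Finₚ.toℕ<n u))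
    (displacement⇒reach _ u w (⟦ w ⟧ - ⟦ u ⟧) ℕₚ.≤-refl (mod-reflexive (b≡a+[b-a] ⟦ u ⟧ ⟦ w ⟧)))
    where
    b≡a+[b-a] : ∀ a b → b ≡ a + (b - a)
    b≡a+[b-a] = solve-∀

  dist-displacement : ∀ u w → ∃ λ t → ∣ t ∣ ≡ dist C u w × (⟦ w ⟧ ≡ ⟦ u ⟧ + t mod + n)
  dist-displacement u w with reach⇒displacement (dist C u w) u w (dist-reached u w)
  ... | t , ∣t∣≤d , w≡u+t = t , ℕₚ.≤-antisym ∣t∣≤d (dist-≤ u w t w≡u+t) , w≡u+t

  dist-self : ∀ x → dist C x x ≡ 0
  dist-self x = ℕₚ.n≤0⇒n≡0 (dist-≤ x x 0ℤ (mod-reflexive (sym (ℤₚ.+-identityʳ ⟦ x ⟧))))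

  dist-reflect-≤ : ∀ {u w u′ w′} → ⟦ u ⟧ + ⟦ u′ ⟧ ≡ ⟦ w ⟧ + ⟦ w′ ⟧ mod + n → dist C u′ w′ ≤ dist C u w
  dist-reflect-≤ {u} {w} {u′} {w′} reflection with dist-displacement u w
  ... | t , ∣t∣≡d , w≡u+t = begin
    dist C u′ w′  ≤⟨ dist-≤ u′ w′ (- t) (reflect-mod ⟦ u ⟧ ⟦ u′ ⟧ t reflection w≡u+t) ⟩
    ∣ - t ∣       ≡⟨ ℤₚ.∣-i∣≡∣i∣ t ⟩
    ∣ t ∣         ≡⟨ ∣t∣≡d ⟩
    dist C u w    ∎
    where open ℕₚ.≤-Reasoning

  dist-reflect : ∀ {u w u′ w′} → ⟦ u ⟧ + ⟦ u′ ⟧ ≡ ⟦ w ⟧ + ⟦ w′ ⟧ mod + n → dist C u w ≡ dist C u′ w′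
  dist-reflect {u} {w} {u′} {w′} reflection = ℕₚ.≤-antisym
    (dist-reflect-≤ (mod-trans (mod-reflexive (ℤₚ.+-comm ⟦ u′ ⟧ ⟦ u ⟧))
                      (mod-trans reflection (mod-reflexive (ℤₚ.+-comm ⟦ w ⟧ ⟦ w′ ⟧)))))
    (dist-reflect-≤ reflection)

  midpoint : ∀ {x y} → Step x y → ℤ
  midpoint {x} s = + 2 * ⟦ x ⟧ + Step.σ s

  midpoint-flip : ∀ {x y} (s : Step x y) → midpoint (Step-flip s) ≡ midpoint s mod + 2 * + n
  midpoint-flip {x} (step {σ} _ y≡x+σ) = midpoint-flip-mod ⟦ x ⟧ σ y≡x+σ

  record Offset (c : ℤ) (v : Fin n) (d : ℕ) : Set where
    constructor offset
    field
      s        : ℤ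
      ∣s∣≡2d+1 : ∣ s ∣ ≡ suc (2 ℕ.* d)
      2v≡c+s   : + 2 * ⟦ v ⟧ ≡ c + s mod + 2 * + n

  Offset-resp : ∀ {c c′ v d} → c ≡ c′ mod + 2 * + n → Offset c v d → Offset c′ v d
  Offset-resp c≡c′ (offset s ∣s∣≡2d+1 2v≡c+s) = offset s ∣s∣≡2d+1 (mod-trans 2v≡c+s (+-cong-mod c≡c′ mod-refl))

  offset-from-nearer-end : ∀ {x y v} (s : Step x y) → dist C x v ≤ dist C y v → Offset (midpoint s) v (dist C x v)
  offset-from-nearer-end {x} {y} {v} (step {σ} unit y≡x+σ) x≤y with dist-displacement x v
  ... | t , ∣t∣≡d , v≡x+t with ∣t-σ∣<∣t∣⊎∣2t-σ∣≡1+2∣t∣ unit t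
  ...   | inj₂ ∣2t-σ∣≡1+2∣t∣ =
    offset (+ 2 * t - σ) (trans ∣2t-σ∣≡1+2∣t∣ (cong (λ d → suc (2 ℕ.* d)) ∣t∣≡d)) (*2-displacement-mod ⟦ x ⟧ t σ v≡x+t)
  ...   | inj₁ ∣t-σ∣<∣t∣ = ⊥-elim (ℕₚ.<-irrefl refl (begin-strict
    dist C x v  ≤⟨ x≤y ⟩
    dist C y v  ≤⟨ dist-≤ y v (t - σ) v≡y+[t-σ] ⟩
    ∣ t - σ ∣   <⟨ ∣t-σ∣<∣t∣ ⟩
    ∣ t ∣       ≡⟨ ∣t∣≡d ⟩
    dist C x v  ∎))
    where
    open ℕₚ.≤-Reasoning
    v≡y+[t-σ] : ⟦ v ⟧ ≡ ⟦ y ⟧ + (t - σ) mod + n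
    v≡y+[t-σ] = mod-trans (displace-trans ⟦ y ⟧ (- σ) t (displace-flip ⟦ x ⟧ σ y≡x+σ) v≡x+t)
                          (mod-reflexive (cong (λ s → ⟦ y ⟧ + s) (ℤₚ.+-comm (- σ) t)))

  step-offset : ∀ {x y} (s : Step x y) v → Offset (midpoint s) v (dist C x v ℕ.⊓ dist C y v)
  step-offset {x} {y} s v with ℕₚ.≤-total (dist C x v) (dist C y v)
  ... | inj₁ x≤y = subst (Offset (midpoint s) v) (sym (ℕₚ.m≤n⇒m⊓n≡m x≤y)) (offset-from-nearer-end s x≤y)
  ... | inj₂ y≤x = subst (Offset (midpoint s) v) (sym (ℕₚ.m≥n⇒m⊓n≡n y≤x))
                     (Offset-resp (midpoint-flip s) (offset-from-nearer-end (Step-flip s) y≤x))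

  same-direction : ∀ {x₁ y₁ x₂ y₂} (s₁ : Step x₁ y₁) (s₂ : Step x₂ y₂) → Step.σ s₁ ≡ Step.σ s₂ →
                   midpoint s₁ ≡ midpoint s₂ mod + 2 * + n → x₁ ≡ x₂ × y₁ ≡ y₂
  same-direction {x₁} {y₁} {x₂} {y₂} (step {σ} _ y₁≡x₁+σ) (step _ y₂≡x₂+σ) refl mid≡mid =
    ⟦⟧-injective-mod x₁≡x₂ , ⟦⟧-injective-mod (begin
      ⟦ y₁ ⟧      ≈⟨ y₁≡x₁+σ ⟩
      ⟦ x₁ ⟧ + σ  ≈⟨ +-cong-mod x₁≡x₂ (mod-refl {a = σ}) ⟩
      ⟦ x₂ ⟧ + σ  ≈⟨ y₂≡x₂+σ ⟨
      ⟦ y₂ ⟧      ∎)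
    where
    open ModReasoning (+ n)
    x₁≡x₂ : ⟦ x₁ ⟧ ≡ ⟦ x₂ ⟧ mod + n
    x₁≡x₂ = *-cancelˡ-mod (+ 2) (+-cancelʳ-mod σ mid≡mid)

  midpoint-injective : ∀ {x₁ y₁ x₂ y₂} (s₁ : Step x₁ y₁) (s₂ : Step x₂ y₂) → midpoint s₁ ≡ midpoint s₂ mod + 2 * + n →
                       (x₁ ≡ x₂ × y₁ ≡ y₂) ⊎ (x₁ ≡ y₂ × y₁ ≡ x₂)
  midpoint-injective s₁@(step one       _) s₂@(step one       _) = inj₁ ∘ same-direction s₁ s₂ refl
  midpoint-injective s₁@(step minus-one _) s₂@(step minus-one _) = inj₁ ∘ same-direction s₁ s₂ refl
  midpoint-injective s₁@(step one       _) s₂@(step minus-one _) =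
    inj₂ ∘ same-direction s₁ (Step-flip s₂) refl ∘ λ mid≡mid → mod-trans mid≡mid (mod-sym (midpoint-flip s₂))
  midpoint-injective s₁@(step minus-one _) s₂@(step one       _) =
    inj₂ ∘ same-direction s₁ (Step-flip s₂) refl ∘ λ mid≡mid → mod-trans mid≡mid (mod-sym (midpoint-flip s₂))

  edgeStep : (e : Edge C) → Step (proj₁ e) (proj₁ (proj₂ e))
  edgeStep (_ , _ , adj) = adjacent⇒Step adj

  edgeMidpoint : Edge C → ℤ
  edgeMidpoint e = midpoint (edgeStep e)

  equidistant⇒midpoint-sum : ∀ e₁ e₂ v → DistinctEdges {G = C} e₁ e₂ → edgeDist C e₁ v ≡ edgeDist C e₂ v →
                             + 2 * (+ 2 * ⟦ v ⟧) ≡ edgeMidpoint e₁ + edgeMidpoint e₂ mod + 2 * + n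
  equidistant⇒midpoint-sum e₁ e₂ v (e₁≢e₂ , e₁≢e₂ᵒᵖ) d₁≡d₂
    with step-offset (edgeStep e₁) v | step-offset (edgeStep e₂) v
  ... | offset s₁ ∣s₁∣≡ 2v≡m₁+s₁ | offset s₂ ∣s₂∣≡ 2v≡m₂+s₂
    with ∣i∣≡∣j∣⇒i≡±j s₁ s₂ (trans ∣s₁∣≡ (trans (cong (λ d → suc (2 ℕ.* d)) d₁≡d₂) (sym ∣s₂∣≡)))
  ... | inj₁ refl = ⊥-elim (Sum.[ e₁≢e₂ , e₁≢e₂ᵒᵖ ] (midpoint-injective (edgeStep e₁) (edgeStep e₂)
                      (+-cancelʳ-mod s₁ (mod-trans (mod-sym 2v≡m₁+s₁) 2v≡m₂+s₂))))
  ... | inj₂ refl = opposite-offsets-mod (edgeMidpoint e₁) (edgeMidpoint e₂) s₂ 2v≡m₁+s₁ 2v≡m₂+s₂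

  unresolved⇒2v≡2w : ∀ e₁ e₂ v w → DistinctEdges {G = C} e₁ e₂ →
                     ¬ T (inR C e₁ e₂ v) → ¬ T (inR C e₁ e₂ w) → + 2 * ⟦ v ⟧ ≡ + 2 * ⟦ w ⟧ mod + n
  unresolved⇒2v≡2w e₁ e₂ v w e₁≢e₂ v-unresolved w-unresolved = *-cancelˡ-mod (+ 2) (mod-trans
    (equidistant⇒midpoint-sum e₁ e₂ v e₁≢e₂ (unresolved⇒equidistant C e₁ e₂ v v-unresolved))
    (mod-sym (equidistant⇒midpoint-sum e₁ e₂ w e₁≢e₂ (unresolved⇒equidistant C e₁ e₂ w w-unresolved))))

  module _ (h : ℕ) (n≡1+2h : n ≡ suc (h ℕ.+ h)) where

    unresolved-unique-odd : ∀ e₁ e₂ → DistinctEdges {G = C} e₁ e₂ →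
                            ∀ v w → ¬ T (inR C e₁ e₂ v) → ¬ T (inR C e₁ e₂ w) → v ≡ w
    unresolved-unique-odd e₁ e₂ e₁≢e₂ v w v-unresolved w-unresolved =
      ⟦⟧-injective-mod (subst (⟦ v ⟧ ≡ ⟦ w ⟧ mod_) (sym +n≡1+2h)
        (*2-cancel-mod-odd (+ h) (subst (+ 2 * ⟦ v ⟧ ≡ + 2 * ⟦ w ⟧ mod_) +n≡1+2h
          (unresolved⇒2v≡2w e₁ e₂ v w e₁≢e₂ v-unresolved w-unresolved))))
      where
      +n≡1+2h : + n ≡ 1ℤ + (+ h + + h)
      +n≡1+2h = cong +_ n≡1+2h

  module _ (h : ℕ) (n≡2h : n ≡ h ℕ.+ h) where

    private
      +n≡2h : + n ≡ + h + + h
      +n≡2h = cong +_ n≡2h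

      ≡-mod-2h⇒≡ : ∀ {x y} → ⟦ x ⟧ ≡ ⟦ y ⟧ mod + h + + h → x ≡ y
      ≡-mod-2h⇒≡ {x} {y} = ⟦⟧-injective-mod ∘ subst (⟦ x ⟧ ≡ ⟦ y ⟧ mod_) (sym +n≡2h)

    pigeonhole-halves : ∀ {u v w} → ⟦ u ⟧ ≡ ⟦ v ⟧ mod + h → ⟦ v ⟧ ≡ ⟦ w ⟧ mod + h → u ≡ v ⊎ u ≡ w ⊎ v ≡ w
    pigeonhole-halves u≡v v≡w = by-halves (mod-halves u≡v) (mod-halves v≡w)
      where
      by-halves : ∀ {u v w} → ⟦ u ⟧ ≡ ⟦ v ⟧ mod + h + + h ⊎ ⟦ u ⟧ ≡ ⟦ v ⟧ + + h mod + h + + h →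
                  ⟦ v ⟧ ≡ ⟦ w ⟧ mod + h + + h ⊎ ⟦ v ⟧ ≡ ⟦ w ⟧ + + h mod + h + + h → u ≡ v ⊎ u ≡ w ⊎ v ≡ w
      by-halves (inj₁ u≡v)   _            = inj₁ (≡-mod-2h⇒≡ u≡v)
      by-halves (inj₂ _)     (inj₁ v≡w)   = inj₂ (inj₂ (≡-mod-2h⇒≡ v≡w))
      by-halves (inj₂ u≡v+h) (inj₂ v≡w+h) = inj₂ (inj₁ (≡-mod-2h⇒≡ (half-shifts-mod (+ h) u≡v+h v≡w+h)))

    unresolved-at-most-two-even : ∀ e₁ e₂ → DistinctEdges {G = C} e₁ e₂ → ∀ u v w →
      ¬ T (inR C e₁ e₂ u) → ¬ T (inR C e₁ e₂ v) → ¬ T (inR C e₁ e₂ w) → u ≡ v ⊎ u ≡ w ⊎ v ≡ w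
    unresolved-at-most-two-even e₁ e₂ e₁≢e₂ u v w u-unresolved v-unresolved w-unresolved =
      pigeonhole-halves (≡-mod-h u v u-unresolved v-unresolved) (≡-mod-h v w v-unresolved w-unresolved)
      where
      ≡-mod-h : ∀ x y → ¬ T (inR C e₁ e₂ x) → ¬ T (inR C e₁ e₂ y) → ⟦ x ⟧ ≡ ⟦ y ⟧ mod + h
      ≡-mod-h x y x-unresolved y-unresolved = *2-cancel-mod-even (+ h)
        (subst (+ 2 * ⟦ x ⟧ ≡ + 2 * ⟦ y ⟧ mod_) +n≡2h (unresolved⇒2v≡2w e₁ e₂ x y e₁≢e₂ x-unresolved y-unresolved))

  shift : ℤ → Fin n → Fin n
  shift c x = residue (⟦ x ⟧ + c)

  ⟦shift⟧ : ∀ c x → ⟦ shift c x ⟧ ≡ ⟦ x ⟧ + c mod + n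
  ⟦shift⟧ c x = ⟦residue⟧ (⟦ x ⟧ + c)

  shift-inverse : ∀ c x → shift (- c) (shift c x) ≡ x
  shift-inverse c x =
    ⟦⟧-injective-mod (mod-trans (⟦shift⟧ (- c) (shift c x)) (mod-sym (displace-flip ⟦ x ⟧ c (⟦shift⟧ c x))))

  shift-inverse′ : ∀ c x → shift c (shift (- c) x) ≡ x
  shift-inverse′ c x = subst (λ c′ → shift c′ (shift (- c) x) ≡ x) (ℤₚ.neg-involutive c) (shift-inverse (- c) x)

  shift-permutation : ℤ → Permutation′ n
  shift-permutation c = permutation (shift c) (shift (- c)) (shift-inverse′ c) (shift-inverse c)

  sumFin-shift : ∀ c (g : Fin n → ℚ) → sumFin (g ∘ shift c) ≡ sumFin g
  sumFin-shift c g = sumFin-permute g (shift-permutation c)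

  shift-no-fixpoint : ∀ {k} x → 0 < k → k < n → shift (+ k) x ≢ x
  shift-no-fixpoint {k} x 0<k k<n x+k≡x = ℕₚ.<-irrefl (sym k≡0) 0<k
    where
    x≡x+k : ⟦ x ⟧ ≡ ⟦ x ⟧ + + k mod + n
    x≡x+k = subst (λ y → ⟦ y ⟧ ≡ ⟦ x ⟧ + + k mod + n) x+k≡x (⟦shift⟧ (+ k) x)
    k≡0 : k ≡ 0
    k≡0 = +-mod-bounded⇒≡ k<n (ℕₚ.≤-<-trans z≤n k<n) (self-displacement-mod ⟦ x ⟧ (+ k) x≡x+k)

  next : Fin n → Fin n
  next = shift 1ℤ

  edgeFrom : Fin n → Edge C
  edgeFrom x = x , next x , Step⇒adjacent (step one (⟦shift⟧ 1ℤ x))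

  consecutive-edges-distinct : 2 < n → ∀ x → DistinctEdges {G = C} (edgeFrom x) (edgeFrom (next x))
  consecutive-edges-distinct 2<n x =
    (λ (x≡x+1 , _) → shift-no-fixpoint x (s≤s z≤n) (ℕₚ.<-trans (s≤s (s≤s z≤n)) 2<n) (sym x≡x+1)) ,
    (λ (x≡x+2 , _) → shift-no-fixpoint x (s≤s z≤n) 2<n (trans shift-twice (sym x≡x+2)))
    where
    shift-twice : shift (+ 2) x ≡ next (next x)
    shift-twice = ⟦⟧-injective-mod (mod-trans (⟦shift⟧ (+ 2) x)
                    (mod-sym (displace-trans ⟦ x ⟧ 1ℤ 1ℤ (⟦shift⟧ 1ℤ x) (⟦shift⟧ 1ℤ (next x)))))

  next-unresolved : ∀ x → ¬ T (inR C (edgeFrom x) (edgeFrom (next x)) (next x))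
  next-unresolved x = equidistant⇒unresolved C (edgeFrom x) (edgeFrom (next x)) y (begin
    dist C x y ℕ.⊓ dist C y y         ≡⟨ cong (dist C x y ℕ.⊓_) (dist-self y) ⟩
    dist C x y ℕ.⊓ 0                  ≡⟨ ℕₚ.⊓-zeroʳ (dist C x y) ⟩
    0                                 ≡⟨ cong (ℕ._⊓ dist C (next y) y) (dist-self y) ⟨
    dist C y y ℕ.⊓ dist C (next y) y  ∎)
    where
    open ≡-Reasoning
    y : Fin n
    y = next x

  next-blind-bound : 2 < n → ∀ {g} → IsEdgeResolving C g → ∀ x → 1ℚ ℚ.+ g (next x) ℚ.≤ sumFin g
  next-blind-bound 2<n {g} g-resolving x =
    subst (λ w → 1ℚ ℚ.+ w ℚ.≤ sumFin g) (weight-singleton g (next x))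
      (blind-weight-bound C g-resolving (edgeFrom x) (edgeFrom (next x)) (consecutive-edges-distinct 2<n x) _
        (singleton-unresolved C (edgeFrom x) (edgeFrom (next x)) (next x) (next-unresolved x)))

  sumFin-next : ∀ (g : Fin n → ℚ) → sumFin (g ∘ next) ≡ 1 · sumFin g
  sumFin-next g = trans (sumFin-shift 1ℤ g) (sym (ℚₚ.+-identityʳ (sumFin g)))

  module _ (h : ℕ) (n≡2h : n ≡ h ℕ.+ h) (2<n : 2 < n) where

    antipode : Fin n → Fin n
    antipode x = shift (+ h) (next x)

    private
      0<h : 0 < h
      0<h = 2<h+h⇒0<h h (subst (2 <_) n≡2h 2<n)
        where
        2<h+h⇒0<h : ∀ h → 2 < h ℕ.+ h → 0 < h
        2<h+h⇒0<h (suc h) _ = s≤s z≤n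

      h<n : h < n
      h<n = subst (h <_) (sym n≡2h) (ℕₚ.m<m+n h 0<h)

    antipode≢next : ∀ x → antipode x ≢ next x
    antipode≢next x = shift-no-fixpoint (next x) 0<h h<n

    antipode-unresolved : ∀ x → ¬ T (inR C (edgeFrom x) (edgeFrom (next x)) (antipode x))
    antipode-unresolved x = equidistant⇒unresolved C (edgeFrom x) (edgeFrom (next x)) a
      (trans (cong (ℕ._⊓ dist C y a) (dist-reflect x+y′≡a+a)) (ℕₚ.⊓-comm (dist C (next y) a) (dist C y a)))
      where
      y : Fin n
      y = next x
      a : Fin n
      a = antipode x
      x+y′≡a+a : ⟦ x ⟧ + ⟦ next y ⟧ ≡ ⟦ a ⟧ + ⟦ a ⟧ mod + n
      x+y′≡a+a = begin
        ⟦ x ⟧ + ⟦ next y ⟧             ≈⟨ +-cong-mod (displace-flip ⟦ x ⟧ 1ℤ (⟦shift⟧ 1ℤ x)) (⟦shift⟧ 1ℤ y) ⟩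
        (⟦ y ⟧ + -1ℤ) + (⟦ y ⟧ + 1ℤ)   ≈⟨ subst ((⟦ y ⟧ + -1ℤ) + (⟦ y ⟧ + 1ℤ) ≡ (⟦ y ⟧ + + h) + (⟦ y ⟧ + + h) mod_)
                                            (cong +_ (sym n≡2h)) (antipodal-mod ⟦ y ⟧ (+ h)) ⟩
        (⟦ y ⟧ + + h) + (⟦ y ⟧ + + h)  ≈⟨ +-cong-mod (⟦shift⟧ (+ h) y) (⟦shift⟧ (+ h) y) ⟨
        ⟦ a ⟧ + ⟦ a ⟧                  ∎
        where open ModReasoning (+ n)

    next-antipode-blind-bound : ∀ {g} → IsEdgeResolving C g → ∀ x →
                                1ℚ ℚ.+ (g (next x) ℚ.+ g (antipode x)) ℚ.≤ sumFin g
    next-antipode-blind-bound {g} g-resolving x =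
      subst (λ w → 1ℚ ℚ.+ w ℚ.≤ sumFin g)
        (trans (weight-∨ g disjoint) (cong₂ ℚ._+_ (weight-singleton g (next x)) (weight-singleton g (antipode x))))
        (blind-weight-bound C g-resolving (edgeFrom x) (edgeFrom (next x)) (consecutive-edges-distinct 2<n x) _ blind)
      where
      blind : ∀ v → T (does (v Finₚ.≟ next x) ∨ does (v Finₚ.≟ antipode x)) →
              ¬ T (inR C (edgeFrom x) (edgeFrom (next x)) v)
      blind v v∈B with Equivalence.to Boolₚ.T-∨ v∈B
      ... | inj₁ v≡y = singleton-unresolved C (edgeFrom x) (edgeFrom (next x)) (next x) (next-unresolved x) v v≡y
      ... | inj₂ v≡a = singleton-unresolved C (edgeFrom x) (edgeFrom (next x)) (antipode x) (antipode-unresolved x) v v≡a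
      disjoint : ∀ v → T (does (v Finₚ.≟ next x)) → ¬ T (does (v Finₚ.≟ antipode x))
      disjoint v with v Finₚ.≟ next x | v Finₚ.≟ antipode x
      ... | yes refl | yes v≡a = λ _ _ → antipode≢next x (sym v≡a)
      ... | yes _    | no _    = λ _ ()
      ... | no _     | _       = λ ()

    sumFin-next+antipode : ∀ (g : Fin n → ℚ) → sumFin (λ x → g (next x) ℚ.+ g (antipode x)) ≡ 2 · sumFin g
    sumFin-next+antipode g = begin
      sumFin (λ x → g (next x) ℚ.+ g (antipode x))           ≡⟨ sumFin-+ (g ∘ next) (g ∘ antipode) ⟩
      sumFin (g ∘ next) ℚ.+ sumFin (g ∘ shift (+ h) ∘ next)  ≡⟨ cong₂ ℚ._+_ (sumFin-shift 1ℤ g)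
                                                                  (trans (sumFin-shift 1ℤ (g ∘ shift (+ h))) (sumFin-shift (+ h) g)) ⟩
      sumFin g ℚ.+ sumFin g                                  ≡⟨ cong (sumFin g ℚ.+_) (ℚₚ.+-identityʳ (sumFin g)) ⟨
      2 · sumFin g                                           ∎
      where open ≡-Reasoning

mainTheorem11 : (n : ℕ) → (h : 3 ≤ n) →
    (n % 2 ≡ 1 → FracEdgeDim (cycle n) (ratio n (n ∸ 1) (n∸1>0 h))) ×
    (n % 2 ≡ 0 → FracEdgeDim (cycle n) (ratio n (n ∸ 2) (n∸2>0 h)))
mainTheorem11 n@(suc (suc (suc n₀))) 2<n@(s≤s (s≤s (s≤s _))) = odd , even
  where
  open Cycle n
  half : ℕ
  half = n ℕ./ 2

  odd : n % 2 ≡ 1 → FracEdgeDim C (ratio n (n ∸ 1) (n∸1>0 2<n))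
  odd n-odd =
    constant-edge-resolving C (suc n₀) (λ e₁ e₂ e₁≢e₂ →
      count-≥-∸1 (inR C e₁ e₂) (unresolved-unique-odd half n≡1+2h e₁ e₂ e₁≢e₂)) ,
    λ g g-resolving → averaging-bound 1 (suc n₀) (g ∘ next) (next-blind-bound 2<n g-resolving) (sumFin-next g)
    where
    n≡1+2h : n ≡ suc (half ℕ.+ half)
    n≡1+2h = trans (n≡n%2+[n/2+n/2] n) (cong (ℕ._+ (half ℕ.+ half)) n-odd)

  even : n % 2 ≡ 0 → FracEdgeDim C (ratio n (n ∸ 2) (n∸2>0 2<n))
  even n-even =
    constant-edge-resolving C n₀ (λ e₁ e₂ e₁≢e₂ →
      count-≥-∸2 (inR C e₁ e₂) (unresolved-at-most-two-even half n≡2h e₁ e₂ e₁≢e₂)) ,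
    λ g g-resolving → averaging-bound 2 n₀ (λ x → g (next x) ℚ.+ g (antipode half n≡2h 2<n x))
      (next-antipode-blind-bound half n≡2h 2<n g-resolving) (sumFin-next+antipode half n≡2h 2<n g)
    where
    n≡2h : n ≡ half ℕ.+ half
    n≡2h = trans (n≡n%2+[n/2+n/2] n) (cong (ℕ._+ (half ℕ.+ half)) n-even)
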